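{- Let $d\in\{1,2,3\}$, let $L_d$ be a line in $\mathbb{C}$ containing one of the line segments forming $\partial U_d$, and let $z\in\mathbb{Q}(\sqrt{ -d})$. Then the reflection $\hat z$ of $z$ across $L_d$ lies in $\mathbb{Q}(\sqrt{ -d})$, and the Ford spheres $\mathcal{F}_d(z)$ and $\mathcal{F}_d(\hat z)$ have the same radius.
   Context: $\omega_1=i$, $\omega_2=\sqrt{ -2}$, $\omega_3=\frac{1+\sqrt{ -3}}2$. $U_1=\{x+yi:-\tfrac12\le x<\tfrac12,\ -\tfrac12\le y<\tfrac12\}$, $U_2=\{x+yi:-\tfrac12\le x<\tfrac12,\ -\tfrac{\sqrt2}2\le y<\tfrac{\sqrt2}2\}$, and $U_3$ is the hexagon with vertices $(\pm\tfrac12,\pm\tfrac1{2\sqrt3})$, $(0,\pm\tfrac1{\sqrt3})$ (its boundary consists of $6$ segments; $\partial U_1,\partial U_2$ consist of $4$ segments). For $z=\frac pq\in\mathbb{Q}(\sqrt{ -d})$ with $p,q\in\mathbb{Z}[\omega_d]$ coprime, the Ford sphere $\mathcal{F}_d(z)$ is the Euclidean sphere in $\mathbb{C}\times[0,\infty)$ with center $(\frac pq,\frac1{2|q|^2})$ and radius $\frac1{2|q|^2}$. -}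

module Defs where

open import Data.Nat as ℕ using (ℕ)
open import Data.Integer as ℤ using (ℤ; +_)
open import Data.Rational as ℚ using (ℚ; 0ℚ; 1ℚ; _≟_; ≢-nonZero; 1/_)
  renaming (_+_ to _+ℚ_; _*_ to _*ℚ_; _-_ to _-ℚ_; -_ to -ℚ_; _/_ to _/ℚ_)
open import Data.Fin using (Fin; zero; suc)
open import Data.Product using (_×_; _,_; Σ; ∃; proj₁; proj₂)
open import Relation.Nullary using (yes; no; ¬_)
open import Relation.Binary.PropositionalEquality using (_≡_; _≢_)

data D : Set where
  d1 d2 d3 : D

dval : D → ℕ
dval d1 = 1
dval d2 = 2
dval d3 = 3

dℤ : D → ℤ
dℤ d = + dval d

dℚ : D → ℚ
dℚ d = (+ dval d) /ℚ 1

infix 10 _//_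
_//_ : ℤ → (m : ℕ) → .{{_ : ℕ.NonZero m}} → ℚ
n // m = n /ℚ m

-- total inverse on ℚ (value 0 at 0; only ever used at nonzero arguments)
qinv : ℚ → ℚ
qinv p with p ≟ 0ℚ
... | yes _ = 0ℚ
... | no ne = 1/_ p {{≢-nonZero ne}}

-- The imaginary quadratic field Q(√-d): a pair (a , b) denotes a + b√-d.

QF : Set
QF = ℚ × ℚ

_+Q_ : QF → QF → QF
(a , b) +Q (c , e) = (a +ℚ c , b +ℚ e)

mulQ : D → QF → QF → QF
mulQ d (a , b) (c , e) = (a *ℚ c -ℚ dℚ d *ℚ (b *ℚ e) , a *ℚ e +ℚ b *ℚ c)

-- The ring of integers Z[ω_d]: a pair (m , n) denotes m + n ω_d, with
-- ω_1 = i, ω_2 = √-2, ω_3 = (1 + √-3)/2.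

Zω : Set
Zω = ℤ × ℤ

ωQ : D → QF
ωQ d1 = (0ℚ , 1ℚ)
ωQ d2 = (0ℚ , 1ℚ)
ωQ d3 = ((+ 1) // 2 , (+ 1) // 2)

ℤtoℚ : ℤ → ℚ
ℤtoℚ n = n /ℚ 1

toQF : D → Zω → QF
toQF d (m , n) = (ℤtoℚ m , 0ℚ) +Q mulQ d (ℤtoℚ n , 0ℚ) (ωQ d)

-- ring operations on Z[ω_d] (ω_1² = -1, ω_2² = -2, ω_3² = ω_3 - 1)
mulZ : D → Zω → Zω → Zω
mulZ d1 (a , b) (c , e) = (a ℤ.* c ℤ.- b ℤ.* e , a ℤ.* e ℤ.+ b ℤ.* c)
mulZ d2 (a , b) (c , e) = (a ℤ.* c ℤ.- + 2 ℤ.* (b ℤ.* e) , a ℤ.* e ℤ.+ b ℤ.* c)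
mulZ d3 (a , b) (c , e) = (a ℤ.* c ℤ.- b ℤ.* e , a ℤ.* e ℤ.+ b ℤ.* c ℤ.+ b ℤ.* e)

oneZ zeroZ : Zω
oneZ = (+ 1 , + 0)
zeroZ = (+ 0 , + 0)

Divides : D → Zω → Zω → Set
Divides d g p = ∃ λ r → p ≡ mulZ d g r

IsUnit : D → Zω → Set
IsUnit d u = ∃ λ v → mulZ d u v ≡ oneZ

Coprime : D → Zω → Zω → Set
Coprime d p q = ∀ g → Divides d g p → Divides d g q → IsUnit d g

ReducedRep : D → QF → Zω → Zω → Set
ReducedRep d z p q = Coprime d p q × (q ≢ zeroZ) × (mulQ d z (toQF d q) ≡ toQF d p)

absSq : D → QF → ℚ
absSq d (a , b) = a *ℚ a +ℚ dℚ d *ℚ (b *ℚ b)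

fordRadius : D → Zω → ℚ
fordRadius d q = qinv (((+ 2) // 1) *ℚ absSq d (toQF d q))

-- Real coordinates.  The points of C involved have coordinates in the
-- real field K = Q(√δ) (δ = 2, 2, 3 for d = 1, 2, 3); a pair (a , b)
-- denotes a + b√δ.

δ : D → ℚ
δ d1 = (+ 2) // 1
δ d2 = (+ 2) // 1
δ d3 = (+ 3) // 1

K : Set
K = ℚ × ℚ

_+K_ _-K_ : K → K → K
(a , b) +K (c , e) = (a +ℚ c , b +ℚ e)
(a , b) -K (c , e) = (a -ℚ c , b -ℚ e)

mulK : D → K → K → K
mulK d (a , b) (c , e) = (a *ℚ c +ℚ δ d *ℚ (b *ℚ e) , a *ℚ e +ℚ b *ℚ c)

-- inverse in K: (a + b√δ)⁻¹ = (a - b√δ)/(a² - δ b²)  (0 at 0)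
invK : D → K → K
invK d (a , b) = let n = qinv (a *ℚ a -ℚ δ d *ℚ (b *ℚ b)) in (a *ℚ n , -ℚ (b *ℚ n))

ofℚ : ℚ → K
ofℚ a = (a , 0ℚ)

sqrtd : D → K
sqrtd d1 = (1ℚ , 0ℚ)
sqrtd d2 = (0ℚ , 1ℚ)
sqrtd d3 = (0ℚ , 1ℚ)

Pt : Set
Pt = K × K

_+P_ _-P_ : Pt → Pt → Pt
(x , y) +P (u , v) = (x +K u , y +K v)
(x , y) -P (u , v) = (x -K u , y -K v)

scaleP : D → K → Pt → Pt
scaleP d t (x , y) = (mulK d t x , mulK d t y)

dotP : D → Pt → Pt → K
dotP d (x , y) (u , v) = mulK d x u +K mulK d y v

-- the point a + b√-d ∈ C has real coordinates (a , b√d)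
embed : D → QF → Pt
embed d (a , b) = (ofℚ a , mulK d (ofℚ b) (sqrtd d))

reflect : D → Pt × Pt → Pt → Pt
reflect d (P , Q) X =
  let v = Q -P P
      w = X -P P
      t = mulK d (ofℚ ((+ 2) // 1)) (mulK d (dotP d w v) (invK d (dotP d v v)))
  in (P +P scaleP d t v) -P w

nEdges : D → ℕ
nEdges d1 = 4
nEdges d2 = 4
nEdges d3 = 6

-- vertices in cyclic order
vertex : (d : D) → Fin (nEdges d) → Pt
vertex d1 zero                   = (ofℚ ((+ 1) // 2)    , ofℚ ((+ 1) // 2))
vertex d1 (suc zero)             = (ofℚ ((+ 1) // 2)    , ofℚ ((ℤ.- (+ 1)) // 2))
vertex d1 (suc (suc zero))       = (ofℚ ((ℤ.- (+ 1)) // 2) , ofℚ ((ℤ.- (+ 1)) // 2))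
vertex d1 (suc (suc (suc zero))) = (ofℚ ((ℤ.- (+ 1)) // 2) , ofℚ ((+ 1) // 2))
vertex d2 zero                   = (ofℚ ((+ 1) // 2)    , (0ℚ , (+ 1) // 2))
vertex d2 (suc zero)             = (ofℚ ((+ 1) // 2)    , (0ℚ , (ℤ.- (+ 1)) // 2))
vertex d2 (suc (suc zero))       = (ofℚ ((ℤ.- (+ 1)) // 2) , (0ℚ , (ℤ.- (+ 1)) // 2))
vertex d2 (suc (suc (suc zero))) = (ofℚ ((ℤ.- (+ 1)) // 2) , (0ℚ , (+ 1) // 2))
-- U_3: hexagon (0, 1/√3), (1/2, 1/(2√3)), (1/2, -1/(2√3)), (0, -1/√3),
--      (-1/2, -1/(2√3)), (-1/2, 1/(2√3));  1/√3 = √3/3, 1/(2√3) = √3/6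
vertex d3 zero                               = (ofℚ 0ℚ , (0ℚ , (+ 1) // 3))
vertex d3 (suc zero)                         = (ofℚ ((+ 1) // 2) , (0ℚ , (+ 1) // 6))
vertex d3 (suc (suc zero))                   = (ofℚ ((+ 1) // 2) , (0ℚ , (ℤ.- (+ 1)) // 6))
vertex d3 (suc (suc (suc zero)))             = (ofℚ 0ℚ , (0ℚ , (ℤ.- (+ 1)) // 3))
vertex d3 (suc (suc (suc (suc zero))))       = (ofℚ ((ℤ.- (+ 1)) // 2) , (0ℚ , (ℤ.- (+ 1)) // 6))
vertex d3 (suc (suc (suc (suc (suc zero))))) = (ofℚ ((ℤ.- (+ 1)) // 2) , (0ℚ , (+ 1) // 6))

nextIdx : (d : D) → Fin (nEdges d) → Fin (nEdges d)
nextIdx d1 zero = suc zero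
nextIdx d1 (suc zero) = suc (suc zero)
nextIdx d1 (suc (suc zero)) = suc (suc (suc zero))
nextIdx d1 (suc (suc (suc zero))) = zero
nextIdx d2 zero = suc zero
nextIdx d2 (suc zero) = suc (suc zero)
nextIdx d2 (suc (suc zero)) = suc (suc (suc zero))
nextIdx d2 (suc (suc (suc zero))) = zero
nextIdx d3 zero = suc zero
nextIdx d3 (suc zero) = suc (suc zero)
nextIdx d3 (suc (suc zero)) = suc (suc (suc zero))
nextIdx d3 (suc (suc (suc zero))) = suc (suc (suc (suc zero)))
nextIdx d3 (suc (suc (suc (suc zero)))) = suc (suc (suc (suc (suc zero))))
nextIdx d3 (suc (suc (suc (suc (suc zero))))) = zero

-- the i-th boundary segment of U_d, given by its endpoints; the line L_d
-- containing it is the line through these two points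
edge : (d : D) → Fin (nEdges d) → Pt × Pt
edge d i = (vertex d i , vertex d (nextIdx d i))

-- The reflection in a side of ∂U_d is z ↦ t + u z̄ with t, u ∈ ℤ[ω_d] and u a unit.
-- So if z = p/q in lowest terms, then ẑ = (t q̄ + u p̄)/q̄.  For d = 1, 2, 3 the ring ℤ[ω_d]
-- is norm-Euclidean, so every fraction in lowest terms has a denominator dividing every
-- other denominator of the same number: the reduced denominator q̂ of ẑ divides q̄ and,
-- the reflection being an involution, q divides the conjugate of q̂.  Hence |q|² = |q̂|²,
-- and the two Ford spheres have the same radius 1/(2|q|²).
module Submission where

open import Defs
open import Data.Fin using (Fin)
open import Data.Product using (Σ; _×_)
open import Relation.Binary.PropositionalEquality using (_≡_)

import Level
open import Level using (0ℓ)
open import Algebra.Bundles using (CommutativeRing)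
open import Algebra.Bundles.Raw using (RawRing)
open import Algebra.Solver.Ring.AlmostCommutativeRing using (AlmostCommutativeRing; fromCommutativeRing)
open import Data.Fin using (zero; suc; #_)
open import Data.Integer as ℤ using (ℤ; +_; 0ℤ; 1ℤ; -1ℤ)
open import Data.Integer.DivMod using (_/ℕ_; _%ℕ_; n%ℕd<d; a≡a%ℕn+[a/ℕn]*n)
import Data.Integer.Properties as ℤP
import Data.Integer.Tactic.RingSolver as ℤ-Solver
open import Data.Nat as ℕ using (ℕ)
open import Data.Nat.Divisibility using (divides; ∣-antisym) renaming (_∣_ to _∣ℕ_)
open import Data.Nat.Induction using (<-wellFounded)
import Data.Nat.Properties as ℕP
import Data.Nat.Tactic.RingSolver as ℕ-Solver
open import Data.Product using (∃; _,_; proj₁; proj₂)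
open import Data.Product.Properties using (≡-dec)
open import Data.Rational as ℚ using (ℚ; 0ℚ)
import Data.Rational.Properties as ℚP
open import Data.Rational.Unnormalised as ℚᵘ using (mkℚᵘ; *≡*)
import Data.Rational.Unnormalised.Properties as ℚᵘP
open import Data.Sum using (inj₁; inj₂; [_,_]′)
open import Data.Vec using (Vec; []; _∷_)
open import Function using (_on_; _∘_; id)
open import Induction.WellFounded using (Acc; acc)
import Relation.Binary.Construct.On as On
open import Relation.Binary.Definitions using (Decidable)
open import Relation.Binary.PropositionalEquality
  using (_≢_; refl; sym; trans; cong; cong₂; subst; isEquivalence; module ≡-Reasoning)
open import Relation.Nullary using (¬_; Dec; yes; no)
open import Relation.Nullary.Negation using (contradiction)

module PolynomialPairs
  (R : AlmostCommutativeRing 0ℓ 0ℓ) (_≟_ : Decidable (AlmostCommutativeRing._≈_ R))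
  (≈⇒≡ : ∀ {x y} → AlmostCommutativeRing._≈_ R x y → x ≡ y)
  where

  open AlmostCommutativeRing R using (Carrier; _≈_; 0#; 1#)
  open import Algebra.Solver.Ring.Simple R _≟_ public
    using (Polynomial; con; var; _:+_; _:*_; _:-_; :-_; ⟦_⟧; ⟦_⟧↓; prove)

  polynomials : ℕ → RawRing 0ℓ 0ℓ
  polynomials m = record
    { Carrier = Polynomial m ; _≈_ = _≡_ ; _+_ = _:+_ ; _*_ = _:*_ ; -_ = :-_ ; 0# = con 0# ; 1# = con 1# }

  ⟦_⟧² : ∀ {m} → Polynomial m × Polynomial m → Vec Carrier m → Carrier × Carrier
  ⟦ a , b ⟧² ρ = (⟦ a ⟧ ρ , ⟦ b ⟧ ρ)

  prove² : ∀ {m} (ρ : Vec Carrier m) (X Y : Polynomial m × Polynomial m) →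
    ⟦ proj₁ X ⟧↓ ρ ≈ ⟦ proj₁ Y ⟧↓ ρ → ⟦ proj₂ X ⟧↓ ρ ≈ ⟦ proj₂ Y ⟧↓ ρ → ⟦ X ⟧² ρ ≡ ⟦ Y ⟧² ρ
  prove² ρ (a , b) (c , e) a≈c b≈e = cong₂ _,_ (≈⇒≡ (prove ρ a c a≈c)) (≈⇒≡ (prove ρ b e b≈e))

module ℤ-Polynomials = PolynomialPairs (fromCommutativeRing ℤP.+-*-commutativeRing) ℤP._≟_ id
module ℚ-Polynomials = PolynomialPairs (fromCommutativeRing ℚP.+-*-commutativeRing) ℚP._≟_ id

record Euclidean {c ℓ} (R : CommutativeRing c ℓ) : Set (c Level.⊔ ℓ) where
  open CommutativeRing R
  field
    _≟0 : ∀ x → Dec (x ≈ 0#)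
    μ : Carrier → ℕ
    divide : ∀ a b → ¬ b ≈ 0# → ∃ λ κ → μ (a - κ * b) ℕ.< μ b

module EuclideanDomain {c ℓ} {R : CommutativeRing c ℓ} (E : Euclidean R) where

  open CommutativeRing R renaming (refl to ≈-refl; sym to ≈-sym; trans to ≈-trans)
  open Euclidean E
  open import Relation.Binary.Reasoning.Setoid setoid
  open import Algebra.Solver.Ring.NaturalCoefficients.Default commutativeSemiring
    using (solve; _:=_; _:+_; _:*_)
  open import Algebra.Properties.AbelianGroup +-abelianGroup using (//-rightDividesˡ)
  open import Algebra.Properties.Ring ring using (-‿distribˡ-*; -‿distribʳ-*)

  infix 4 _∣_
  _∣_ : Carrier → Carrier → Set (c Level.⊔ ℓ)
  g ∣ a = ∃ λ r → a ≈ g * r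

  Invertible : Carrier → Set (c Level.⊔ ℓ)
  Invertible u = ∃ λ v → u * v ≈ 1#

  RelativelyPrime : Carrier → Carrier → Set (c Level.⊔ ℓ)
  RelativelyPrime a b = ∀ g → g ∣ a → g ∣ b → Invertible g

  record ExtendedGCD (a b : Carrier) : Set (c Level.⊔ ℓ) where
    field
      gcd s t : Carrier
      gcd∣a : gcd ∣ a
      gcd∣b : gcd ∣ b
      bezout : gcd ≈ s * a + t * b

  extendedGCD : ∀ a b → ExtendedGCD a b
  extendedGCD a b = go a b (On.wellFounded μ <-wellFounded b)
    where
    go : ∀ a b → Acc (ℕ._<_ on μ) b → ExtendedGCD a b
    go a b (acc rec) with b ≟0
    ... | yes b≈0 = record
      { gcd = a ; s = 1# ; t = 0#
      ; gcd∣a = 1# , ≈-sym (*-identityʳ a)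
      ; gcd∣b = 0# , ≈-trans b≈0 (≈-sym (zeroʳ a))
      ; bezout = ≈-sym (≈-trans (+-cong (*-identityˡ a) (zeroˡ b)) (+-identityʳ a))
      }
    ... | no b≉0 = record
      { gcd = gcd ; s = t ; t = s - t * κ
      ; gcd∣a = ρ + κ * β , (begin
          a                          ≈⟨ ≈-sym (//-rightDividesˡ (κ * b) a) ⟩
          (a - κ * b) + κ * b        ≈⟨ +-cong r≈gρ (*-congˡ b≈gβ) ⟩
          gcd * ρ + κ * (gcd * β)    ≈⟨ solve 4 (λ g ρ κ β → g :* ρ :+ κ :* (g :* β) := g :* (ρ :+ κ :* β)) ≈-refl gcd ρ κ β ⟩
          gcd * (ρ + κ * β)          ∎)
      ; gcd∣b = β , b≈gβ
      ; bezout = begin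
          gcd                        ≈⟨ bezout ⟩
          s * b + t * (a - κ * b)    ≈⟨ +-congˡ (*-congˡ (+-congˡ (-‿distribˡ-* κ b))) ⟩
          s * b + t * (a + - κ * b)  ≈⟨ solve 5 (λ s t a b m → s :* b :+ t :* (a :+ m :* b) := t :* a :+ (s :+ t :* m) :* b)
                                               ≈-refl s t a b (- κ) ⟩
          t * a + (s + t * - κ) * b  ≈⟨ +-congˡ (*-congʳ (+-congˡ (≈-sym (-‿distribʳ-* t κ)))) ⟩
          t * a + (s - t * κ) * b    ∎
      }
      where
      κ = proj₁ (divide a b b≉0)
      open ExtendedGCD (go b (a - κ * b) (rec (proj₂ (divide a b b≉0))))
      β = proj₁ gcd∣a
      b≈gβ = proj₂ gcd∣a
      ρ = proj₁ gcd∣b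
      r≈gρ = proj₂ gcd∣b

  relativelyPrime⇒bezout : ∀ {a b} → RelativelyPrime a b → ∃ λ s → ∃ λ t → s * a + t * b ≈ 1#
  relativelyPrime⇒bezout {a} {b} a⊥b = s * w , t * w , (begin
    s * w * a + t * w * b   ≈⟨ solve 5 (λ s t w a b → s :* w :* a :+ t :* w :* b := (s :* a :+ t :* b) :* w) ≈-refl s t w a b ⟩
    (s * a + t * b) * w     ≈⟨ *-congʳ (≈-sym bezout) ⟩
    gcd * w                 ≈⟨ gcd*w≈1 ⟩
    1#                      ∎)
    where
    open ExtendedGCD (extendedGCD a b)
    w = proj₁ (a⊥b gcd gcd∣a gcd∣b)
    gcd*w≈1 = proj₂ (a⊥b gcd gcd∣a gcd∣b)

  relativelyPrime-denominator-∣ : ∀ {p q p′ q′} → RelativelyPrime p q → p * q′ ≈ p′ * q → q ∣ q′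
  relativelyPrime-denominator-∣ {p} {q} {p′} {q′} p⊥q pq′≈p′q = s * p′ + t * q′ , (begin
    q′                            ≈⟨ ≈-sym (*-identityʳ q′) ⟩
    q′ * 1#                       ≈⟨ *-congˡ (≈-sym sp+tq≈1) ⟩
    q′ * (s * p + t * q)          ≈⟨ solve 5 (λ q′ s p t q → q′ :* (s :* p :+ t :* q) := s :* (p :* q′) :+ q :* (t :* q′))
                                           ≈-refl q′ s p t q ⟩
    s * (p * q′) + q * (t * q′)   ≈⟨ +-congʳ (*-congˡ pq′≈p′q) ⟩
    s * (p′ * q) + q * (t * q′)   ≈⟨ solve 5 (λ s p′ q t q′ → s :* (p′ :* q) :+ q :* (t :* q′) := q :* (s :* p′ :+ t :* q′))
                                           ≈-refl s p′ q t q′ ⟩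
    q * (s * p′ + t * q′)         ∎)
    where
    s = proj₁ (relativelyPrime⇒bezout p⊥q)
    t = proj₁ (proj₂ (relativelyPrime⇒bezout p⊥q))
    sp+tq≈1 = proj₂ (proj₂ (relativelyPrime⇒bezout p⊥q))

module Quadratic {c ℓ} (R : RawRing c ℓ) (t n : RawRing.Carrier R) where
  open RawRing R

  -- (a , b) stands for a + b ω, where ω² = t ω - n.
  infixl 7 _*ω_
  infixl 6 _+ω_

  _+ω_ _*ω_ : Carrier × Carrier → Carrier × Carrier → Carrier × Carrier
  (a , b) +ω (c , e) = (a + c , b + e)
  (a , b) *ω (c , e) = (a * c + - (n * (b * e)) , a * e + b * c + t * (b * e))

  -ω_ conjω : Carrier × Carrier → Carrier × Carrier
  -ω (a , b) = (- a , - b)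
  conjω (a , b) = (a + t * b , - b)

  normω : Carrier × Carrier → Carrier
  normω (a , b) = a * a + t * (a * b) + n * (b * b)

module ℤ[ω] (t n : ℤ) where
  open Quadratic ℤ.+-*-rawRing t n public

  private
    open ℤ-Polynomials
    module S = Quadratic (polynomials 8) (var (# 0)) (var (# 1))

    x̃ ỹ z̃ : Polynomial 8 × Polynomial 8
    x̃ = (var (# 2) , var (# 3))
    ỹ = (var (# 4) , var (# 5))
    z̃ = (var (# 6) , var (# 7))

    env : Zω → Zω → Zω → Vec ℤ 8
    env (a , b) (c , e) (f , g) = t ∷ n ∷ a ∷ b ∷ c ∷ e ∷ f ∷ g ∷ []

  *ω-assoc : ∀ x y z → (x *ω y) *ω z ≡ x *ω (y *ω z)
  *ω-assoc x y z = prove² (env x y z) ((x̃ S.*ω ỹ) S.*ω z̃) (x̃ S.*ω (ỹ S.*ω z̃)) refl refl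

  *ω-comm : ∀ x y → x *ω y ≡ y *ω x
  *ω-comm x y = prove² (env x y zeroZ) (x̃ S.*ω ỹ) (ỹ S.*ω x̃) refl refl

  *ω-identityˡ : ∀ x → oneZ *ω x ≡ x
  *ω-identityˡ x = prove² (env x zeroZ zeroZ) ((con 1ℤ , con 0ℤ) S.*ω x̃) x̃ refl refl

  *ω-identityʳ : ∀ x → x *ω oneZ ≡ x
  *ω-identityʳ x = prove² (env x zeroZ zeroZ) (x̃ S.*ω (con 1ℤ , con 0ℤ)) x̃ refl refl

  *ω-distribˡ : ∀ x y z → x *ω (y +ω z) ≡ x *ω y +ω x *ω z
  *ω-distribˡ x y z = prove² (env x y z) (x̃ S.*ω (ỹ S.+ω z̃)) (x̃ S.*ω ỹ S.+ω x̃ S.*ω z̃) refl refl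

  *ω-distribʳ : ∀ x y z → (y +ω z) *ω x ≡ y *ω x +ω z *ω x
  *ω-distribʳ x y z = prove² (env x y z) ((ỹ S.+ω z̃) S.*ω x̃) (ỹ S.*ω x̃ S.+ω z̃ S.*ω x̃) refl refl

  commutativeRing : CommutativeRing 0ℓ 0ℓ
  commutativeRing = record
    { Carrier = Zω
    ; _≈_ = _≡_
    ; _+_ = _+ω_
    ; _*_ = _*ω_
    ; -_ = -ω_
    ; 0# = zeroZ
    ; 1# = oneZ
    ; isCommutativeRing = record
      { isRing = record
        { +-isAbelianGroup = record
          { isGroup = record
            { isMonoid = record
              { isSemigroup = record
                { isMagma = record { isEquivalence = isEquivalence ; ∙-cong = cong₂ _+ω_ }
                ; assoc = λ { (a , b) (c , e) (f , g) → cong₂ _,_ (ℤP.+-assoc a c f) (ℤP.+-assoc b e g) }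
                }
              ; identity = (λ { (a , b) → cong₂ _,_ (ℤP.+-identityˡ a) (ℤP.+-identityˡ b) })
                         , (λ { (a , b) → cong₂ _,_ (ℤP.+-identityʳ a) (ℤP.+-identityʳ b) })
              }
            ; inverse = (λ { (a , b) → cong₂ _,_ (ℤP.+-inverseˡ a) (ℤP.+-inverseˡ b) })
                      , (λ { (a , b) → cong₂ _,_ (ℤP.+-inverseʳ a) (ℤP.+-inverseʳ b) })
            ; ⁻¹-cong = cong -ω_
            }
          ; comm = λ { (a , b) (c , e) → cong₂ _,_ (ℤP.+-comm a c) (ℤP.+-comm b e) }
          }
        ; *-cong = cong₂ _*ω_
        ; *-assoc = *ω-assoc
        ; *-identity = *ω-identityˡ , *ω-identityʳ
        ; distrib = *ω-distribˡ , *ω-distribʳ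
        }
      ; *-comm = *ω-comm
      }
    }

  norm-* : ∀ x y → normω (x *ω y) ≡ normω x ℤ.* normω y
  norm-* x y = prove (env x y zeroZ) (S.normω (x̃ S.*ω ỹ)) (S.normω x̃ :* S.normω ỹ) refl

  norm-conj : ∀ x → normω (conjω x) ≡ normω x
  norm-conj x = prove (env x zeroZ zeroZ) (S.normω (S.conjω x̃)) (S.normω x̃) refl

  norm-double : ∀ a b → normω (+ 2 ℤ.* a , + 2 ℤ.* b) ≡ + 4 ℤ.* normω (a , b)
  norm-double a b = prove (env (a , b) zeroZ zeroZ)
    (S.normω (con (+ 2) :* proj₁ x̃ , con (+ 2) :* proj₂ x̃)) (con (+ 4) :* S.normω x̃) refl

  four-norm-completed : ∀ a b → + 4 ℤ.* normω (a , b)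
    ≡ (+ 2 ℤ.* a ℤ.+ t ℤ.* b) ℤ.* (+ 2 ℤ.* a ℤ.+ t ℤ.* b) ℤ.+ (+ 4 ℤ.* n ℤ.- t ℤ.* t) ℤ.* (b ℤ.* b)
  four-norm-completed a b = prove (env (a , b) zeroZ zeroZ) (con (+ 4) :* S.normω x̃)
    (c̃ :* c̃ :+ (con (+ 4) :* var (# 1) :- var (# 0) :* var (# 0)) :* (proj₂ x̃ :* proj₂ x̃)) refl
    where c̃ = con (+ 2) :* proj₁ x̃ :+ var (# 0) :* proj₂ x̃

  remainder-*-conj : ∀ a b k l → (a +ω -ω ((k , l) *ω b)) *ω conjω b
    ≡ (proj₁ (a *ω conjω b) ℤ.- k ℤ.* normω b , proj₂ (a *ω conjω b) ℤ.- l ℤ.* normω b)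
  remainder-*-conj a b k l = prove² (env a b (k , l))
    ((x̃ S.+ω S.-ω (z̃ S.*ω ỹ)) S.*ω S.conjω ỹ)
    (proj₁ (x̃ S.*ω S.conjω ỹ) :- proj₁ z̃ :* S.normω ỹ , proj₂ (x̃ S.*ω S.conjω ỹ) :- proj₂ z̃ :* S.normω ỹ) refl refl

square : ∀ i → i ℤ.* i ≡ + (ℤ.∣ i ∣ ℕ.* ℤ.∣ i ∣)
square (+ m) = sym (ℤP.pos-* m m)
square ℤ.-[1+ m ] = refl

square≡0 : ∀ i → ℤ.∣ i ∣ ℕ.* ℤ.∣ i ∣ ≡ 0 → i ≡ 0ℤ
square≡0 i i²≡0 = [ ℤP.∣i∣≡0⇒i≡0 , ℤP.∣i∣≡0⇒i≡0 ]′ (ℕP.m*n≡0⇒m≡0∨n≡0 ℤ.∣ i ∣ i²≡0)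

∣m⊖n∣≤n : ∀ {m n} → m ℕ.< n ℕ.+ n → ℤ.∣ m ℤ.⊖ n ∣ ℕ.≤ n
∣m⊖n∣≤n {m} {n} m<2n with ℕP.≤-<-connex m n
... | inj₁ m≤n = subst (ℕ._≤ n) (sym (ℤP.∣⊖∣-≤ m≤n)) (ℕP.m∸n≤m n m)
... | inj₂ n<m = subst (ℕ._≤ n) (sym (trans (ℤP.∣m⊖n∣≡∣n⊖m∣ m n) (ℤP.∣⊖∣-< n<m)))
  (ℕP.<⇒≤ (subst (m ℕ.∸ n ℕ.<_) (ℕP.m+n∸n≡m n n) (ℕP.∸-monoˡ-< m<2n (ℕP.<⇒≤ n<m))))

-- k is the integer nearest to x / m: the floor of (2x + m) / 2m.
nearest-multiple : ∀ x m .{{_ : ℕ.NonZero m}} → ∃ λ k → ℤ.∣ + 2 ℤ.* (x ℤ.- k ℤ.* + m) ∣ ℕ.≤ m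
nearest-multiple x m = k , subst (λ e → ℤ.∣ e ∣ ℕ.≤ m) (sym 2[x-km]≡r⊖m) (∣m⊖n∣≤n (n%ℕd<d y (m ℕ.+ m)))
  where
  instance
    2m≢0 : ℕ.NonZero (m ℕ.+ m)
    2m≢0 = ℕ.≢-nonZero (ℕ.≢-nonZero⁻¹ m ∘ ℕP.m+n≡0⇒m≡0 m)
  y = + 2 ℤ.* x ℤ.+ + m
  r = y %ℕ (m ℕ.+ m)
  k = y /ℕ (m ℕ.+ m)
  shift : ∀ x k r m → + 2 ℤ.* x ℤ.+ m ≡ r ℤ.+ k ℤ.* (m ℤ.+ m) → + 2 ℤ.* (x ℤ.- k ℤ.* m) ≡ r ℤ.- m
  shift x k r m 2x+m≡r+2km = begin
    + 2 ℤ.* (x ℤ.- k ℤ.* m)                            ≡⟨ expand x k m ⟩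
    (+ 2 ℤ.* x ℤ.+ m) ℤ.- k ℤ.* (m ℤ.+ m) ℤ.- m        ≡⟨ cong (λ y → y ℤ.- k ℤ.* (m ℤ.+ m) ℤ.- m) 2x+m≡r+2km ⟩
    (r ℤ.+ k ℤ.* (m ℤ.+ m)) ℤ.- k ℤ.* (m ℤ.+ m) ℤ.- m  ≡⟨ cancel r k m ⟩
    r ℤ.- m                                             ∎
    where
    open ≡-Reasoning
    expand : ∀ x k m → + 2 ℤ.* (x ℤ.- k ℤ.* m) ≡ (+ 2 ℤ.* x ℤ.+ m) ℤ.- k ℤ.* (m ℤ.+ m) ℤ.- m
    expand = ℤ-Solver.solve-∀
    cancel : ∀ r k m → (r ℤ.+ k ℤ.* (m ℤ.+ m)) ℤ.- k ℤ.* (m ℤ.+ m) ℤ.- m ≡ r ℤ.- m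
    cancel = ℤ-Solver.solve-∀
  2[x-km]≡r⊖m : + 2 ℤ.* (x ℤ.- k ℤ.* + m) ≡ r ℤ.⊖ m
  2[x-km]≡r⊖m = trans
    (shift x k (+ r) (+ m) (trans (a≡a%ℕn+[a/ℕn]*n y (m ℕ.+ m)) (cong (λ 2m → + r ℤ.+ k ℤ.* 2m) (ℤP.pos-+ m m))))
    (ℤP.m-n≡m⊖n r m)

module Norm (t n : ℕ) where
  open ℤ[ω] (+ t) (+ n) public

  μ : Zω → ℕ
  μ x = ℤ.∣ normω x ∣

  μ-* : ∀ x y → μ (x *ω y) ≡ μ x ℕ.* μ y
  μ-* x y = trans (cong ℤ.∣_∣ (norm-* x y)) (ℤP.abs-* (normω x) (normω y))

  μ-conj : ∀ x → μ (conjω x) ≡ μ x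
  μ-conj x = cong ℤ.∣_∣ (norm-conj x)

  μ-double : ∀ e f → μ (+ 2 ℤ.* e , + 2 ℤ.* f) ≡ 4 ℕ.* μ (e , f)
  μ-double e f = trans (cong ℤ.∣_∣ (norm-double e f)) (ℤP.abs-* (+ 4) (normω (e , f)))

  μ-bound : ∀ {e f m} → ℤ.∣ e ∣ ℕ.≤ m → ℤ.∣ f ∣ ℕ.≤ m → μ (e , f) ℕ.≤ (1 ℕ.+ t ℕ.+ n) ℕ.* (m ℕ.* m)
  μ-bound {e} {f} {m} e≤m f≤m = begin
    ℤ.∣ e ℤ.* e ℤ.+ + t ℤ.* (e ℤ.* f) ℤ.+ + n ℤ.* (f ℤ.* f) ∣
      ≤⟨ ℕP.≤-trans (ℤP.∣i+j∣≤∣i∣+∣j∣ (e ℤ.* e ℤ.+ + t ℤ.* (e ℤ.* f)) _)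
           (ℕP.+-monoˡ-≤ ℤ.∣ + n ℤ.* (f ℤ.* f) ∣ (ℤP.∣i+j∣≤∣i∣+∣j∣ (e ℤ.* e) _)) ⟩
    ℤ.∣ e ℤ.* e ∣ ℕ.+ ℤ.∣ + t ℤ.* (e ℤ.* f) ∣ ℕ.+ ℤ.∣ + n ℤ.* (f ℤ.* f) ∣
      ≡⟨ cong₂ ℕ._+_ (cong₂ ℕ._+_ (ℤP.abs-* e e) (trans (ℤP.abs-* (+ t) _) (cong (t ℕ.*_) (ℤP.abs-* e f))))
                     (trans (ℤP.abs-* (+ n) _) (cong (n ℕ.*_) (ℤP.abs-* f f))) ⟩
    ℤ.∣ e ∣ ℕ.* ℤ.∣ e ∣ ℕ.+ t ℕ.* (ℤ.∣ e ∣ ℕ.* ℤ.∣ f ∣) ℕ.+ n ℕ.* (ℤ.∣ f ∣ ℕ.* ℤ.∣ f ∣)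
      ≤⟨ ℕP.+-mono-≤ (ℕP.+-mono-≤ (ℕP.*-mono-≤ e≤m e≤m) (ℕP.*-monoʳ-≤ t (ℕP.*-mono-≤ e≤m f≤m)))
                     (ℕP.*-monoʳ-≤ n (ℕP.*-mono-≤ f≤m f≤m)) ⟩
    m ℕ.* m ℕ.+ t ℕ.* (m ℕ.* m) ℕ.+ n ℕ.* (m ℕ.* m)
      ≡⟨ collect t n m ⟩
    (1 ℕ.+ t ℕ.+ n) ℕ.* (m ℕ.* m) ∎
    where
    open ℕP.≤-Reasoning
    collect : ∀ t n m → m ℕ.* m ℕ.+ t ℕ.* (m ℕ.* m) ℕ.+ n ℕ.* (m ℕ.* m) ≡ (1 ℕ.+ t ℕ.+ n) ℕ.* (m ℕ.* m)
    collect = ℕ-Solver.solve-∀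

  module PositiveDefinite (t²<4n : t ℕ.* t ℕ.< 4 ℕ.* n) where

    Δ : ℕ
    Δ = 4 ℕ.* n ℕ.∸ t ℕ.* t

    discriminant : + 4 ℤ.* + n ℤ.- + t ℤ.* + t ≡ + Δ
    discriminant = trans (cong₂ ℤ._-_ (sym (ℤP.pos-* 4 n)) (sym (ℤP.pos-* t t)))
      (trans (ℤP.m-n≡m⊖n (4 ℕ.* n) (t ℕ.* t)) (ℤP.⊖-≥ (ℕP.<⇒≤ t²<4n)))

    sumOfSquares : Zω → ℕ
    sumOfSquares (a , b) = ℤ.∣ c ∣ ℕ.* ℤ.∣ c ∣ ℕ.+ Δ ℕ.* (ℤ.∣ b ∣ ℕ.* ℤ.∣ b ∣)
      where c = + 2 ℤ.* a ℤ.+ + t ℤ.* b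

    four-norm≡sumOfSquares : ∀ x → + 4 ℤ.* normω x ≡ + sumOfSquares x
    four-norm≡sumOfSquares (a , b) = begin
      + 4 ℤ.* normω (a , b)
        ≡⟨ four-norm-completed a b ⟩
      c ℤ.* c ℤ.+ (+ 4 ℤ.* + n ℤ.- + t ℤ.* + t) ℤ.* (b ℤ.* b)
        ≡⟨ cong₂ ℤ._+_ (square c) (cong₂ ℤ._*_ discriminant (square b)) ⟩
      + (ℤ.∣ c ∣ ℕ.* ℤ.∣ c ∣) ℤ.+ + Δ ℤ.* + (ℤ.∣ b ∣ ℕ.* ℤ.∣ b ∣)
        ≡⟨ cong (ℤ._+_ (+ (ℤ.∣ c ∣ ℕ.* ℤ.∣ c ∣))) (sym (ℤP.pos-* Δ (ℤ.∣ b ∣ ℕ.* ℤ.∣ b ∣))) ⟩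
      + (ℤ.∣ c ∣ ℕ.* ℤ.∣ c ∣) ℤ.+ + (Δ ℕ.* (ℤ.∣ b ∣ ℕ.* ℤ.∣ b ∣))
        ≡⟨ sym (ℤP.pos-+ (ℤ.∣ c ∣ ℕ.* ℤ.∣ c ∣) (Δ ℕ.* (ℤ.∣ b ∣ ℕ.* ℤ.∣ b ∣))) ⟩
      + sumOfSquares (a , b) ∎
      where
      open ≡-Reasoning
      c = + 2 ℤ.* a ℤ.+ + t ℤ.* b

    norm≡μ : ∀ x → normω x ≡ + μ x
    norm≡μ x = sym (ℤP.0≤i⇒+∣i∣≡i (ℤP.*-cancelˡ-≤-pos 0ℤ (normω x) (+ 4)
      (subst (0ℤ ℤ.≤_) (sym (four-norm≡sumOfSquares x)) (ℤ.+≤+ ℕ.z≤n))))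

    μ≡0⇒≡0 : ∀ x → μ x ≡ 0 → x ≡ zeroZ
    μ≡0⇒≡0 (a , b) μ≡0 = cong₂ _,_ a≡0 b≡0
      where
      sum≡0 : sumOfSquares (a , b) ≡ 0
      sum≡0 = ℤP.+-injective (trans (sym (four-norm≡sumOfSquares (a , b)))
        (cong (+ 4 ℤ.*_) (trans (norm≡μ (a , b)) (cong +_ μ≡0))))
      b≡0 : b ≡ 0ℤ
      b≡0 = [ (λ Δ≡0 → contradiction Δ≡0 (ℕP.m<n⇒n≢0 (ℕP.m<n⇒0<n∸m t²<4n))) , square≡0 b ]′
        (ℕP.m*n≡0⇒m≡0∨n≡0 Δ (ℕP.m+n≡0⇒n≡0 (ℤ.∣ + 2 ℤ.* a ℤ.+ + t ℤ.* b ∣ ℕ.* ℤ.∣ + 2 ℤ.* a ℤ.+ + t ℤ.* b ∣) sum≡0))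
      2a≡0 : + 2 ℤ.* a ≡ 0ℤ
      2a≡0 = begin
        + 2 ℤ.* a                   ≡⟨ sym (ℤP.+-identityʳ _) ⟩
        + 2 ℤ.* a ℤ.+ 0ℤ            ≡⟨ cong (ℤ._+_ (+ 2 ℤ.* a)) (sym (ℤP.*-zeroʳ (+ t))) ⟩
        + 2 ℤ.* a ℤ.+ + t ℤ.* 0ℤ    ≡⟨ cong (λ b → + 2 ℤ.* a ℤ.+ + t ℤ.* b) (sym b≡0) ⟩
        + 2 ℤ.* a ℤ.+ + t ℤ.* b     ≡⟨ square≡0 _ (ℕP.m+n≡0⇒m≡0 _ sum≡0) ⟩
        0ℤ                          ∎
        where open ≡-Reasoning
      a≡0 : a ≡ 0ℤ
      a≡0 = [ (λ ()) , (λ a≡0 → a≡0) ]′ (ℤP.i*j≡0⇒i≡0∨j≡0 (+ 2) 2a≡0)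

    -- Rounding a b̄ / N(b) to the nearest lattice point κ leaves a remainder of norm
    -- at most (1 + t + n)/4 · N(b), which is less than N(b) when t + n ≤ 2.
    divide : t ℕ.+ n ℕ.≤ 2 → ∀ a b → b ≢ zeroZ → ∃ λ κ → μ (a +ω -ω (κ *ω b)) ℕ.< μ b
    divide t+n≤2 a b b≢0 = κ , ℕP.*-cancelʳ-< m (μ r) m (ℕP.*-cancelˡ-< 4 (μ r ℕ.* m) (m ℕ.* m) 4μr·m<4m²)
      where
      m = μ b
      instance
        m≢0 : ℕ.NonZero m
        m≢0 = ℕ.≢-nonZero (b≢0 ∘ μ≡0⇒≡0 b)
      x = proj₁ (a *ω conjω b)
      y = proj₂ (a *ω conjω b)
      k = proj₁ (nearest-multiple x m)
      l = proj₁ (nearest-multiple y m)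
      κ = (k , l)
      r = a +ω -ω (κ *ω b)
      e = x ℤ.- k ℤ.* + m
      f = y ℤ.- l ℤ.* + m
      μr·m≡μ[e,f] : μ r ℕ.* m ≡ μ (e , f)
      μr·m≡μ[e,f] = trans (cong (μ r ℕ.*_) (sym (μ-conj b))) (trans (sym (μ-* r (conjω b)))
        (cong μ (trans (remainder-*-conj a b k l) (cong (λ N → (x ℤ.- k ℤ.* N , y ℤ.- l ℤ.* N)) (norm≡μ b)))))
      4μr·m<4m² : 4 ℕ.* (μ r ℕ.* m) ℕ.< 4 ℕ.* (m ℕ.* m)
      4μr·m<4m² = begin-strict
        4 ℕ.* (μ r ℕ.* m)               ≡⟨ cong (4 ℕ.*_) μr·m≡μ[e,f] ⟩
        4 ℕ.* μ (e , f)                 ≡⟨ sym (μ-double e f) ⟩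
        μ (+ 2 ℤ.* e , + 2 ℤ.* f)       ≤⟨ μ-bound {+ 2 ℤ.* e} {+ 2 ℤ.* f} (proj₂ (nearest-multiple x m))
                                                                          (proj₂ (nearest-multiple y m)) ⟩
        (1 ℕ.+ t ℕ.+ n) ℕ.* (m ℕ.* m)   ≤⟨ ℕP.*-monoˡ-≤ (m ℕ.* m) (ℕ.s≤s t+n≤2) ⟩
        3 ℕ.* (m ℕ.* m)                 <⟨ ℕP.*-monoˡ-< (m ℕ.* m) {{ℕP.m*n≢0 m m}} (ℕP.n<1+n 3) ⟩
        4 ℕ.* (m ℕ.* m)                 ∎
        where open ℕP.≤-Reasoning

toℚ² : Zω → ℚ × ℚ
toℚ² (a , b) = (ℤtoℚ a , ℤtoℚ b)

ℤtoℚ≃ : ∀ i → ℚ.toℚᵘ (ℤtoℚ i) ℚᵘ.≃ mkℚᵘ i 0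
ℤtoℚ≃ i = ℚP.toℚᵘ-fromℚᵘ (mkℚᵘ i 0)

ℤtoℚ-+ : ∀ i j → ℤtoℚ (i ℤ.+ j) ≡ ℤtoℚ i ℚ.+ ℤtoℚ j
ℤtoℚ-+ i j = ℚP.toℚᵘ-injective (begin
  ℚ.toℚᵘ (ℤtoℚ (i ℤ.+ j))                   ≈⟨ ℤtoℚ≃ (i ℤ.+ j) ⟩
  mkℚᵘ (i ℤ.+ j) 0                           ≈⟨ *≡* (cong (ℤ._* 1ℤ) (cong₂ ℤ._+_ (sym (ℤP.*-identityʳ i)) (sym (ℤP.*-identityʳ j)))) ⟩
  mkℚᵘ i 0 ℚᵘ.+ mkℚᵘ j 0                     ≈⟨ ℚᵘP.+-cong (ℤtoℚ≃ i) (ℤtoℚ≃ j) ⟨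
  ℚ.toℚᵘ (ℤtoℚ i) ℚᵘ.+ ℚ.toℚᵘ (ℤtoℚ j)     ≈⟨ ℚP.toℚᵘ-homo-+ (ℤtoℚ i) (ℤtoℚ j) ⟨
  ℚ.toℚᵘ (ℤtoℚ i ℚ.+ ℤtoℚ j)                ∎)
  where open ℚᵘP.≃-Reasoning

ℤtoℚ-* : ∀ i j → ℤtoℚ (i ℤ.* j) ≡ ℤtoℚ i ℚ.* ℤtoℚ j
ℤtoℚ-* i j = ℚP.toℚᵘ-injective (begin
  ℚ.toℚᵘ (ℤtoℚ (i ℤ.* j))                   ≈⟨ ℤtoℚ≃ (i ℤ.* j) ⟩
  mkℚᵘ (i ℤ.* j) 0                           ≈⟨ *≡* refl ⟩
  mkℚᵘ i 0 ℚᵘ.* mkℚᵘ j 0                     ≈⟨ ℚᵘP.*-cong (ℤtoℚ≃ i) (ℤtoℚ≃ j) ⟨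
  ℚ.toℚᵘ (ℤtoℚ i) ℚᵘ.* ℚ.toℚᵘ (ℤtoℚ j)     ≈⟨ ℚP.toℚᵘ-homo-* (ℤtoℚ i) (ℤtoℚ j) ⟨
  ℚ.toℚᵘ (ℤtoℚ i ℚ.* ℤtoℚ j)                ∎)
  where open ℚᵘP.≃-Reasoning

ℤtoℚ-neg : ∀ i → ℤtoℚ (ℤ.- i) ≡ ℚ.- ℤtoℚ i
ℤtoℚ-neg i = ℚP.toℚᵘ-injective (begin
  ℚ.toℚᵘ (ℤtoℚ (ℤ.- i))     ≈⟨ ℤtoℚ≃ (ℤ.- i) ⟩
  mkℚᵘ (ℤ.- i) 0            ≈⟨ ℚᵘP.-‿cong (ℤtoℚ≃ i) ⟨
  ℚᵘ.- ℚ.toℚᵘ (ℤtoℚ i)      ≈⟨ ℚP.toℚᵘ-homo‿- (ℤtoℚ i) ⟨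
  ℚ.toℚᵘ (ℚ.- ℤtoℚ i)       ∎)
  where open ℚᵘP.≃-Reasoning

ℤtoℚ-injective : ∀ {i j} → ℤtoℚ i ≡ ℤtoℚ j → i ≡ j
ℤtoℚ-injective {i} {j} eq with ℚᵘP.≃-trans (ℚᵘP.≃-sym (ℤtoℚ≃ i)) (ℚᵘP.≃-trans (ℚP.toℚᵘ-cong eq) (ℤtoℚ≃ j))
... | *≡* i*1≡j*1 = trans (sym (ℤP.*-identityʳ i)) (trans i*1≡j*1 (ℤP.*-identityʳ j))

ℤtoℚ-*-* : ∀ i j k → ℤtoℚ (i ℤ.* (j ℤ.* k)) ≡ ℤtoℚ i ℚ.* (ℤtoℚ j ℚ.* ℤtoℚ k)
ℤtoℚ-*-* i j k = trans (ℤtoℚ-* i (j ℤ.* k)) (cong (ℤtoℚ i ℚ.*_) (ℤtoℚ-* j k))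

module ℤ[ω]toℚ[ω] (t n : ℤ) where
  private
    module Z = Quadratic ℤ.+-*-rawRing t n
    module Q = Quadratic ℚ.+-*-rawRing (ℤtoℚ t) (ℤtoℚ n)

  toℚ²-+ω : ∀ x y → toℚ² (x Z.+ω y) ≡ toℚ² x Q.+ω toℚ² y
  toℚ²-+ω (a , b) (c , e) = cong₂ _,_ (ℤtoℚ-+ a c) (ℤtoℚ-+ b e)

  toℚ²-*ω : ∀ x y → toℚ² (x Z.*ω y) ≡ toℚ² x Q.*ω toℚ² y
  toℚ²-*ω (a , b) (c , e) = cong₂ _,_
    (trans (ℤtoℚ-+ (a ℤ.* c) (ℤ.- (n ℤ.* (b ℤ.* e))))
      (cong₂ ℚ._+_ (ℤtoℚ-* a c) (trans (ℤtoℚ-neg (n ℤ.* (b ℤ.* e))) (cong ℚ.-_ (ℤtoℚ-*-* n b e)))))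
    (trans (ℤtoℚ-+ (a ℤ.* e ℤ.+ b ℤ.* c) (t ℤ.* (b ℤ.* e)))
      (cong₂ ℚ._+_ (trans (ℤtoℚ-+ (a ℤ.* e) (b ℤ.* c)) (cong₂ ℚ._+_ (ℤtoℚ-* a e) (ℤtoℚ-* b c))) (ℤtoℚ-*-* t b e)))

  toℚ²-conj : ∀ x → toℚ² (Z.conjω x) ≡ Q.conjω (toℚ² x)
  toℚ²-conj (a , b) = cong₂ _,_ (trans (ℤtoℚ-+ a (t ℤ.* b)) (cong (ℤtoℚ a ℚ.+_) (ℤtoℚ-* t b))) (ℤtoℚ-neg b)

  ℤtoℚ-norm : ∀ x → ℤtoℚ (Z.normω x) ≡ Q.normω (toℚ² x)
  ℤtoℚ-norm (a , b) = trans (ℤtoℚ-+ (a ℤ.* a ℤ.+ t ℤ.* (a ℤ.* b)) (n ℤ.* (b ℤ.* b)))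
    (cong₂ ℚ._+_ (trans (ℤtoℚ-+ (a ℤ.* a) (t ℤ.* (a ℤ.* b))) (cong₂ ℚ._+_ (ℤtoℚ-* a a) (ℤtoℚ-*-* t a b)))
                 (ℤtoℚ-*-* n b b))

-- ω_d is a root of X² - tr d · X + nm d.
tr nm : D → ℕ
tr d1 = 0
tr d2 = 0
tr d3 = 1
nm d1 = 1
nm d2 = 2
nm d3 = 1

discriminant-negative : ∀ d → tr d ℕ.* tr d ℕ.< 4 ℕ.* nm d
discriminant-negative d1 = ℕ.z<s
discriminant-negative d2 = ℕ.z<s
discriminant-negative d3 = ℕ.s<s ℕ.z<s

tr+nm≤2 : ∀ d → tr d ℕ.+ nm d ℕ.≤ 2
tr+nm≤2 d1 = ℕ.s≤s ℕ.z≤n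
tr+nm≤2 d2 = ℕP.≤-refl
tr+nm≤2 d3 = ℕP.≤-refl

mulZ≡*ω : ∀ d x y → mulZ d x y ≡ ℤ[ω]._*ω_ (+ tr d) (+ nm d) x y
mulZ≡*ω d1 (a , b) (c , e) = cong₂ _,_
  (cong (ℤ._-_ (a ℤ.* c)) (sym (ℤP.*-identityˡ (b ℤ.* e))))
  (sym (trans (cong (ℤ._+_ (a ℤ.* e ℤ.+ b ℤ.* c)) (ℤP.*-zeroˡ (b ℤ.* e))) (ℤP.+-identityʳ _)))
mulZ≡*ω d2 (a , b) (c , e) = cong₂ _,_
  refl
  (sym (trans (cong (ℤ._+_ (a ℤ.* e ℤ.+ b ℤ.* c)) (ℤP.*-zeroˡ (b ℤ.* e))) (ℤP.+-identityʳ _)))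
mulZ≡*ω d3 (a , b) (c , e) = cong₂ _,_
  (cong (ℤ._-_ (a ℤ.* c)) (sym (ℤP.*-identityˡ (b ℤ.* e))))
  (cong (ℤ._+_ (a ℤ.* e ℤ.+ b ℤ.* c)) (sym (ℤP.*-identityˡ (b ℤ.* e))))

module ℚ[ω] (d : D) = Quadratic ℚ.+-*-rawRing (ℤtoℚ (+ tr d)) (ℤtoℚ (+ nm d))

conjQ : QF → QF
conjQ (a , b) = (a , ℚ.- b)

-- toQF d x unfolds to toQF′ d (toℚ² x).
toQF′ : D → ℚ × ℚ → QF
toQF′ d (a , b) = (a , 0ℚ) +Q mulQ d (b , 0ℚ) (ωQ d)

fromQF : D → QF → ℚ × ℚ
fromQF d1 z = z
fromQF d2 z = z
fromQF d3 (a , b) = (a ℚ.- b , (+ 2) // 1 ℚ.* b)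

-- The reflection in the i-th side of ∂U_d is z ↦ t + u z̄ for (u , t) = reflection-coefficients d i.
reflection-coefficients : (d : D) → Fin (nEdges d) → Zω × Zω
reflection-coefficients d1 zero                               = ((-1ℤ , 0ℤ) , (1ℤ , 0ℤ))
reflection-coefficients d1 (suc zero)                         = ((1ℤ , 0ℤ) , (0ℤ , -1ℤ))
reflection-coefficients d1 (suc (suc zero))                   = ((-1ℤ , 0ℤ) , (-1ℤ , 0ℤ))
reflection-coefficients d1 (suc (suc (suc zero)))             = ((1ℤ , 0ℤ) , (0ℤ , 1ℤ))
reflection-coefficients d2 zero                               = ((-1ℤ , 0ℤ) , (1ℤ , 0ℤ))
reflection-coefficients d2 (suc zero)                         = ((1ℤ , 0ℤ) , (0ℤ , -1ℤ))
reflection-coefficients d2 (suc (suc zero))                   = ((-1ℤ , 0ℤ) , (-1ℤ , 0ℤ))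
reflection-coefficients d2 (suc (suc (suc zero)))             = ((1ℤ , 0ℤ) , (0ℤ , 1ℤ))
reflection-coefficients d3 zero                               = ((1ℤ , -1ℤ) , (0ℤ , 1ℤ))
reflection-coefficients d3 (suc zero)                         = ((-1ℤ , 0ℤ) , (1ℤ , 0ℤ))
reflection-coefficients d3 (suc (suc zero))                   = ((0ℤ , 1ℤ) , (1ℤ , -1ℤ))
reflection-coefficients d3 (suc (suc (suc zero)))             = ((1ℤ , -1ℤ) , (0ℤ , -1ℤ))
reflection-coefficients d3 (suc (suc (suc (suc zero))))       = ((-1ℤ , 0ℤ) , (-1ℤ , 0ℤ))
reflection-coefficients d3 (suc (suc (suc (suc (suc zero))))) = ((0ℤ , 1ℤ) , (-1ℤ , 1ℤ))

zhat : (d : D) → Fin (nEdges d) → QF → QF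
zhat d i z = toQF d t +Q mulQ d (toQF d u) (conjQ z)
  where open Σ (reflection-coefficients d i) renaming (proj₁ to u; proj₂ to t)

-- Symbolic copies of the operations of Defs over ℚ, for polynomials in m variables.
-- Evaluating them with ⟦_⟧ gives back the operations of Defs definitionally, so an
-- identity between such operations follows from the normal forms of its symbolic sides.
module Symbolic {m : ℕ} where
  open ℚ-Polynomials public using (Polynomial; con; var; _:+_; _:*_; _:-_; :-_; ⟦_⟧↓; ⟦_⟧²; prove; prove²)
  open ℚ-Polynomials using (polynomials)

  Sym² Symᴾ : Set
  Sym² = Polynomial m × Polynomial m
  Symᴾ = Sym² × Sym²

  module ℚ[ω]ˢ (d : D) = Quadratic (polynomials m) (con (ℤtoℚ (+ tr d))) (con (ℤtoℚ (+ nm d)))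

  ⟦_⟧ᴾ : Symᴾ → Vec ℚ m → Pt
  ⟦ x , y ⟧ᴾ ρ = (⟦ x ⟧² ρ , ⟦ y ⟧² ρ)

  const² : ℚ × ℚ → Sym²
  const² (a , b) = (con a , con b)

  constᴾ : Pt → Symᴾ
  constᴾ (x , y) = (const² x , const² y)

  _+²_ _-²_ : Sym² → Sym² → Sym²
  (a , b) +² (c , e) = (a :+ c , b :+ e)
  (a , b) -² (c , e) = (a :- c , b :- e)

  -- With k a variable, an identity about mulQᵏ k holds for mulQ d for every d at once.
  mulQᵏ : Polynomial m → Sym² → Sym² → Sym²
  mulQᵏ k (a , b) (c , e) = (a :* c :- k :* (b :* e) , a :* e :+ b :* c)

  mulQ² mulK² : D → Sym² → Sym² → Sym²
  mulQ² d = mulQᵏ (con (dℚ d))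
  mulK² d (a , b) (c , e) = (a :* c :+ con (δ d) :* (b :* e) , a :* e :+ b :* c)

  conjQ² : Sym² → Sym²
  conjQ² (a , b) = (a , :- b)

  toQF′² : D → Sym² → Sym²
  toQF′² d (a , b) = (a , con 0ℚ) +² mulQ² d (b , con 0ℚ) (const² (ωQ d))

  fromQF² : D → Sym² → Sym²
  fromQF² d1 z = z
  fromQF² d2 z = z
  fromQF² d3 (a , b) = (a :- b , con ((+ 2) // 1) :* b)

  absSq² : D → Sym² → Polynomial m
  absSq² d (a , b) = a :* a :+ con (dℚ d) :* (b :* b)

  _+ᴾ_ _-ᴾ_ : Symᴾ → Symᴾ → Symᴾ
  (x , y) +ᴾ (u , v) = (x +² u , y +² v)
  (x , y) -ᴾ (u , v) = (x -² u , y -² v)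

  scaleᴾ : D → Sym² → Symᴾ → Symᴾ
  scaleᴾ d s (x , y) = (mulK² d s x , mulK² d s y)

  dotᴾ : D → Symᴾ → Symᴾ → Sym²
  dotᴾ d (x , y) (u , v) = mulK² d x u +² mulK² d y v

  embedᴾ : D → Sym² → Symᴾ
  embedᴾ d (a , b) = ((a , con 0ℚ) , mulK² d (b , con 0ℚ) (const² (sqrtd d)))

  reflectᴾ : D → Pt × Pt → Symᴾ → Symᴾ
  reflectᴾ d (P , Q) X =
    let v = Q -P P
        w = X -ᴾ constᴾ P
        s = mulK² d (const² (ofℚ ((+ 2) // 1))) (mulK² d (dotᴾ d w (constᴾ v)) (const² (invK d (dotP d v v))))
    in (constᴾ P +ᴾ scaleᴾ d s (constᴾ v)) -ᴾ w

  zhat² : (d : D) → Fin (nEdges d) → Sym² → Sym²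
  zhat² d i z = const² (toQF d t) +² mulQ² d (const² (toQF d u)) (conjQ² z)
    where open Σ (reflection-coefficients d i) renaming (proj₁ to u; proj₂ to t)

  proveᴾ : ∀ (ρ : Vec ℚ m) (X Y : Symᴾ) →
    ⟦ proj₁ (proj₁ X) ⟧↓ ρ ≡ ⟦ proj₁ (proj₁ Y) ⟧↓ ρ → ⟦ proj₂ (proj₁ X) ⟧↓ ρ ≡ ⟦ proj₂ (proj₁ Y) ⟧↓ ρ →
    ⟦ proj₁ (proj₂ X) ⟧↓ ρ ≡ ⟦ proj₁ (proj₂ Y) ⟧↓ ρ → ⟦ proj₂ (proj₂ X) ⟧↓ ρ ≡ ⟦ proj₂ (proj₂ Y) ⟧↓ ρ →
    ⟦ X ⟧ᴾ ρ ≡ ⟦ Y ⟧ᴾ ρ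
  proveᴾ ρ (x , y) (u , v) e₁ e₂ e₃ e₄ = cong₂ _,_ (prove² ρ x u e₁ e₂) (prove² ρ y v e₃ e₄)

module QF-Identities where
  open Symbolic {4}

  x̃ ỹ : Sym²
  x̃ = (var (# 0) , var (# 1))
  ỹ = (var (# 2) , var (# 3))

  env : ℚ × ℚ → ℚ × ℚ → Vec ℚ 4
  env (a , b) (c , e) = a ∷ b ∷ c ∷ e ∷ []

  toQF′-+ω : ∀ d x y → toQF′ d (ℚ[ω]._+ω_ d x y) ≡ toQF′ d x +Q toQF′ d y
  toQF′-+ω d1 x y = prove² (env x y) (toQF′² d1 (ℚ[ω]ˢ._+ω_ d1 x̃ ỹ)) (toQF′² d1 x̃ +² toQF′² d1 ỹ) refl refl
  toQF′-+ω d2 x y = prove² (env x y) (toQF′² d2 (ℚ[ω]ˢ._+ω_ d2 x̃ ỹ)) (toQF′² d2 x̃ +² toQF′² d2 ỹ) refl refl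
  toQF′-+ω d3 x y = prove² (env x y) (toQF′² d3 (ℚ[ω]ˢ._+ω_ d3 x̃ ỹ)) (toQF′² d3 x̃ +² toQF′² d3 ỹ) refl refl

  toQF′-*ω : ∀ d x y → toQF′ d (ℚ[ω]._*ω_ d x y) ≡ mulQ d (toQF′ d x) (toQF′ d y)
  toQF′-*ω d1 x y = prove² (env x y) (toQF′² d1 (ℚ[ω]ˢ._*ω_ d1 x̃ ỹ)) (mulQ² d1 (toQF′² d1 x̃) (toQF′² d1 ỹ)) refl refl
  toQF′-*ω d2 x y = prove² (env x y) (toQF′² d2 (ℚ[ω]ˢ._*ω_ d2 x̃ ỹ)) (mulQ² d2 (toQF′² d2 x̃) (toQF′² d2 ỹ)) refl refl
  toQF′-*ω d3 x y = prove² (env x y) (toQF′² d3 (ℚ[ω]ˢ._*ω_ d3 x̃ ỹ)) (mulQ² d3 (toQF′² d3 x̃) (toQF′² d3 ỹ)) refl refl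

  toQF′-conj : ∀ d x → toQF′ d (ℚ[ω].conjω d x) ≡ conjQ (toQF′ d x)
  toQF′-conj d1 x = prove² (env x x) (toQF′² d1 (ℚ[ω]ˢ.conjω d1 x̃)) (conjQ² (toQF′² d1 x̃)) refl refl
  toQF′-conj d2 x = prove² (env x x) (toQF′² d2 (ℚ[ω]ˢ.conjω d2 x̃)) (conjQ² (toQF′² d2 x̃)) refl refl
  toQF′-conj d3 x = prove² (env x x) (toQF′² d3 (ℚ[ω]ˢ.conjω d3 x̃)) (conjQ² (toQF′² d3 x̃)) refl refl

  absSq-toQF′ : ∀ d x → absSq d (toQF′ d x) ≡ ℚ[ω].normω d x
  absSq-toQF′ d1 x = prove (env x x) (absSq² d1 (toQF′² d1 x̃)) (ℚ[ω]ˢ.normω d1 x̃) refl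
  absSq-toQF′ d2 x = prove (env x x) (absSq² d2 (toQF′² d2 x̃)) (ℚ[ω]ˢ.normω d2 x̃) refl
  absSq-toQF′ d3 x = prove (env x x) (absSq² d3 (toQF′² d3 x̃)) (ℚ[ω]ˢ.normω d3 x̃) refl

  fromQF-toQF′ : ∀ d x → fromQF d (toQF′ d x) ≡ x
  fromQF-toQF′ d1 x = prove² (env x x) (fromQF² d1 (toQF′² d1 x̃)) x̃ refl refl
  fromQF-toQF′ d2 x = prove² (env x x) (fromQF² d2 (toQF′² d2 x̃)) x̃ refl refl
  fromQF-toQF′ d3 x = prove² (env x x) (fromQF² d3 (toQF′² d3 x̃)) x̃ refl refl

module QF-Identitiesᵏ where
  open Symbolic {9}

  k̃ : Polynomial 9
  k̃ = var (# 0)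

  x̃ ỹ z̃ w̃ : Sym²
  x̃ = (var (# 1) , var (# 2))
  ỹ = (var (# 3) , var (# 4))
  z̃ = (var (# 5) , var (# 6))
  w̃ = (var (# 7) , var (# 8))

  env : D → QF → QF → QF → QF → Vec ℚ 9
  env d (a , b) (c , e) (f , g) (h , k) = dℚ d ∷ a ∷ b ∷ c ∷ e ∷ f ∷ g ∷ h ∷ k ∷ []

  mulQ-[xy]z≡[xz]y : ∀ d x y z → mulQ d (mulQ d x y) z ≡ mulQ d (mulQ d x z) y
  mulQ-[xy]z≡[xz]y d x y z = prove² (env d x y z z) (mulQᵏ k̃ (mulQᵏ k̃ x̃ ỹ) z̃) (mulQᵏ k̃ (mulQᵏ k̃ x̃ z̃) ỹ) refl refl

  mulQ-affine-conj : ∀ d t u z x →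
    mulQ d (t +Q mulQ d u (conjQ z)) (conjQ x) ≡ mulQ d t (conjQ x) +Q mulQ d u (conjQ (mulQ d z x))
  mulQ-affine-conj d t u z x = prove² (env d t u z x)
    (mulQᵏ k̃ (x̃ +² mulQᵏ k̃ ỹ (conjQ² z̃)) (conjQ² w̃))
    (mulQᵏ k̃ x̃ (conjQ² w̃) +² mulQᵏ k̃ ỹ (conjQ² (mulQᵏ k̃ z̃ w̃))) refl refl

open QF-Identities using (toQF′-+ω; toQF′-*ω; toQF′-conj; absSq-toQF′; fromQF-toQF′)
open QF-Identitiesᵏ using (mulQ-[xy]z≡[xz]y; mulQ-affine-conj)

module Reflection-Identities where
  open Symbolic {2}

  z̃ : Sym²
  z̃ = (var (# 0) , var (# 1))

  zhat-involutive-by-normalisation : ∀ d i a b →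
    let ρ = a ∷ b ∷ [] ; X = zhat² d i (zhat² d i z̃) in
    ⟦ proj₁ X ⟧↓ ρ ≡ ⟦ proj₁ z̃ ⟧↓ ρ → ⟦ proj₂ X ⟧↓ ρ ≡ ⟦ proj₂ z̃ ⟧↓ ρ →
    zhat d i (zhat d i (a , b)) ≡ (a , b)
  zhat-involutive-by-normalisation d i a b = prove² (a ∷ b ∷ []) (zhat² d i (zhat² d i z̃)) z̃

  embed-zhat-by-normalisation : ∀ d i a b →
    let ρ = a ∷ b ∷ [] ; X = embedᴾ d (zhat² d i z̃) ; Y = reflectᴾ d (edge d i) (embedᴾ d z̃) in
    ⟦ proj₁ (proj₁ X) ⟧↓ ρ ≡ ⟦ proj₁ (proj₁ Y) ⟧↓ ρ → ⟦ proj₂ (proj₁ X) ⟧↓ ρ ≡ ⟦ proj₂ (proj₁ Y) ⟧↓ ρ →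
    ⟦ proj₁ (proj₂ X) ⟧↓ ρ ≡ ⟦ proj₁ (proj₂ Y) ⟧↓ ρ → ⟦ proj₂ (proj₂ X) ⟧↓ ρ ≡ ⟦ proj₂ (proj₂ Y) ⟧↓ ρ →
    embed d (zhat d i (a , b)) ≡ reflect d (edge d i) (embed d (a , b))
  embed-zhat-by-normalisation d i a b =
    proveᴾ (a ∷ b ∷ []) (embedᴾ d (zhat² d i z̃)) (reflectᴾ d (edge d i) (embedᴾ d z̃))

open Reflection-Identities using (zhat-involutive-by-normalisation; embed-zhat-by-normalisation)

zhat-involutive : ∀ d i z → zhat d i (zhat d i z) ≡ z
zhat-involutive d1 i@zero                               (a , b) = zhat-involutive-by-normalisation d1 i a b refl refl
zhat-involutive d1 i@(suc zero)                         (a , b) = zhat-involutive-by-normalisation d1 i a b refl refl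
zhat-involutive d1 i@(suc (suc zero))                   (a , b) = zhat-involutive-by-normalisation d1 i a b refl refl
zhat-involutive d1 i@(suc (suc (suc zero)))             (a , b) = zhat-involutive-by-normalisation d1 i a b refl refl
zhat-involutive d2 i@zero                               (a , b) = zhat-involutive-by-normalisation d2 i a b refl refl
zhat-involutive d2 i@(suc zero)                         (a , b) = zhat-involutive-by-normalisation d2 i a b refl refl
zhat-involutive d2 i@(suc (suc zero))                   (a , b) = zhat-involutive-by-normalisation d2 i a b refl refl
zhat-involutive d2 i@(suc (suc (suc zero)))             (a , b) = zhat-involutive-by-normalisation d2 i a b refl refl
zhat-involutive d3 i@zero                               (a , b) = zhat-involutive-by-normalisation d3 i a b refl refl
zhat-involutive d3 i@(suc zero)                         (a , b) = zhat-involutive-by-normalisation d3 i a b refl refl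
zhat-involutive d3 i@(suc (suc zero))                   (a , b) = zhat-involutive-by-normalisation d3 i a b refl refl
zhat-involutive d3 i@(suc (suc (suc zero)))             (a , b) = zhat-involutive-by-normalisation d3 i a b refl refl
zhat-involutive d3 i@(suc (suc (suc (suc zero))))       (a , b) = zhat-involutive-by-normalisation d3 i a b refl refl
zhat-involutive d3 i@(suc (suc (suc (suc (suc zero))))) (a , b) = zhat-involutive-by-normalisation d3 i a b refl refl

embed-zhat : ∀ d i z → embed d (zhat d i z) ≡ reflect d (edge d i) (embed d z)
embed-zhat d1 i@zero                               (a , b) = embed-zhat-by-normalisation d1 i a b refl refl refl refl
embed-zhat d1 i@(suc zero)                         (a , b) = embed-zhat-by-normalisation d1 i a b refl refl refl refl
embed-zhat d1 i@(suc (suc zero))                   (a , b) = embed-zhat-by-normalisation d1 i a b refl refl refl refl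
embed-zhat d1 i@(suc (suc (suc zero)))             (a , b) = embed-zhat-by-normalisation d1 i a b refl refl refl refl
embed-zhat d2 i@zero                               (a , b) = embed-zhat-by-normalisation d2 i a b refl refl refl refl
embed-zhat d2 i@(suc zero)                         (a , b) = embed-zhat-by-normalisation d2 i a b refl refl refl refl
embed-zhat d2 i@(suc (suc zero))                   (a , b) = embed-zhat-by-normalisation d2 i a b refl refl refl refl
embed-zhat d2 i@(suc (suc (suc zero)))             (a , b) = embed-zhat-by-normalisation d2 i a b refl refl refl refl
embed-zhat d3 i@zero                               (a , b) = embed-zhat-by-normalisation d3 i a b refl refl refl refl
embed-zhat d3 i@(suc zero)                         (a , b) = embed-zhat-by-normalisation d3 i a b refl refl refl refl
embed-zhat d3 i@(suc (suc zero))                   (a , b) = embed-zhat-by-normalisation d3 i a b refl refl refl refl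
embed-zhat d3 i@(suc (suc (suc zero)))             (a , b) = embed-zhat-by-normalisation d3 i a b refl refl refl refl
embed-zhat d3 i@(suc (suc (suc (suc zero))))       (a , b) = embed-zhat-by-normalisation d3 i a b refl refl refl refl
embed-zhat d3 i@(suc (suc (suc (suc (suc zero))))) (a , b) = embed-zhat-by-normalisation d3 i a b refl refl refl refl

module RingOfIntegers (d : D) where
  open Norm (tr d) (nm d) public
  open PositiveDefinite (discriminant-negative d) public
  open ℤ[ω]toℚ[ω] (+ tr d) (+ nm d)

  euclidean : Euclidean commutativeRing
  euclidean = record { _≟0 = λ x → ≡-dec ℤP._≟_ ℤP._≟_ x zeroZ ; μ = μ ; divide = divide (tr+nm≤2 d) }

  open EuclideanDomain euclidean public

  coprime⇒relativelyPrime : ∀ {p q} → Coprime d p q → RelativelyPrime p q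
  coprime⇒relativelyPrime coprime g (r , p≡gr) (s , q≡gs) =
    let (v , gv≡1) = coprime g (r , trans p≡gr (sym (mulZ≡*ω d g r))) (s , trans q≡gs (sym (mulZ≡*ω d g s)))
    in v , trans (sym (mulZ≡*ω d g v)) gv≡1

  toQF-*ω : ∀ x y → toQF d (x *ω y) ≡ mulQ d (toQF d x) (toQF d y)
  toQF-*ω x y = trans (cong (toQF′ d) (toℚ²-*ω x y)) (toQF′-*ω d (toℚ² x) (toℚ² y))

  toQF-+ω : ∀ x y → toQF d (x +ω y) ≡ toQF d x +Q toQF d y
  toQF-+ω x y = trans (cong (toQF′ d) (toℚ²-+ω x y)) (toQF′-+ω d (toℚ² x) (toℚ² y))

  toQF-conj : ∀ x → toQF d (conjω x) ≡ conjQ (toQF d x)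
  toQF-conj x = trans (cong (toQF′ d) (toℚ²-conj x)) (toQF′-conj d (toℚ² x))

  absSq-toQF : ∀ x → absSq d (toQF d x) ≡ ℤtoℚ (normω x)
  absSq-toQF x = trans (absSq-toQF′ d (toℚ² x)) (sym (ℤtoℚ-norm x))

  toQF-injective : ∀ {x y} → toQF d x ≡ toQF d y → x ≡ y
  toQF-injective {a , b} {c , e} eq = cong₂ _,_ (ℤtoℚ-injective (cong proj₁ toℚ²-eq)) (ℤtoℚ-injective (cong proj₂ toℚ²-eq))
    where
    toℚ²-eq : toℚ² (a , b) ≡ toℚ² (c , e)
    toℚ²-eq = trans (sym (fromQF-toQF′ d (toℚ² (a , b)))) (trans (cong (fromQF d) eq) (fromQF-toQF′ d (toℚ² (c , e))))

  cross-multiply : ∀ {w p q p′ q′} → mulQ d w (toQF d q) ≡ toQF d p → mulQ d w (toQF d q′) ≡ toQF d p′ →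
                   p *ω q′ ≡ p′ *ω q
  cross-multiply {w} {p} {q} {p′} {q′} wq≡p wq′≡p′ = toQF-injective (begin
    toQF d (p *ω q′)                          ≡⟨ toQF-*ω p q′ ⟩
    mulQ d (toQF d p) (toQF d q′)             ≡⟨ cong (λ x → mulQ d x (toQF d q′)) (sym wq≡p) ⟩
    mulQ d (mulQ d w (toQF d q)) (toQF d q′)  ≡⟨ mulQ-[xy]z≡[xz]y d w (toQF d q) (toQF d q′) ⟩
    mulQ d (mulQ d w (toQF d q′)) (toQF d q)  ≡⟨ cong (λ x → mulQ d x (toQF d q)) wq′≡p′ ⟩
    mulQ d (toQF d p′) (toQF d q)             ≡⟨ toQF-*ω p′ q ⟨
    toQF d (p′ *ω q)                          ∎)
    where open ≡-Reasoning

  reduced-denominator-∣ : ∀ w p q p′ q′ → ReducedRep d w p q → mulQ d w (toQF d q′) ≡ toQF d p′ → q ∣ q′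
  reduced-denominator-∣ w p q p′ q′ (coprime , _ , wq≡p) wq′≡p′ =
    relativelyPrime-denominator-∣ {p} {q} {p′} {q′} (coprime⇒relativelyPrime coprime)
      (cross-multiply {w} {p} {q} {p′} {q′} wq≡p wq′≡p′)

  μ-∣ : ∀ {x y} → x ∣ y → μ x ∣ℕ μ y
  μ-∣ {x} (r , y≡xr) = divides (μ r) (trans (cong μ y≡xr) (trans (μ-* x r) (ℕP.*-comm (μ x) (μ r))))

  reflected-fraction : ∀ i z p q → mulQ d z (toQF d q) ≡ toQF d p →
    ∃ λ p′ → mulQ d (zhat d i z) (toQF d (conjω q)) ≡ toQF d p′
  reflected-fraction i z p q zq≡p = t *ω conjω q +ω u *ω conjω p , (begin
    mulQ d (T +Q mulQ d U (conjQ z)) (toQF d (conjω q))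
      ≡⟨ cong (mulQ d (T +Q mulQ d U (conjQ z))) (toQF-conj q) ⟩
    mulQ d (T +Q mulQ d U (conjQ z)) (conjQ (toQF d q))
      ≡⟨ mulQ-affine-conj d T U z (toQF d q) ⟩
    mulQ d T (conjQ (toQF d q)) +Q mulQ d U (conjQ (mulQ d z (toQF d q)))
      ≡⟨ cong (λ x → mulQ d T (conjQ (toQF d q)) +Q mulQ d U (conjQ x)) zq≡p ⟩
    mulQ d T (conjQ (toQF d q)) +Q mulQ d U (conjQ (toQF d p))
      ≡⟨ cong₂ (λ x y → mulQ d T x +Q mulQ d U y) (toQF-conj q) (toQF-conj p) ⟨
    mulQ d T (toQF d (conjω q)) +Q mulQ d U (toQF d (conjω p))
      ≡⟨ cong₂ _+Q_ (toQF-*ω t (conjω q)) (toQF-*ω u (conjω p)) ⟨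
    toQF d (t *ω conjω q) +Q toQF d (u *ω conjω p)
      ≡⟨ toQF-+ω (t *ω conjω q) (u *ω conjω p) ⟨
    toQF d (t *ω conjω q +ω u *ω conjω p) ∎)
    where
    open ≡-Reasoning
    open Σ (reflection-coefficients d i) renaming (proj₁ to u; proj₂ to t)
    U = toQF d u
    T = toQF d t

  reflection-preserves-norm : ∀ i {z p q p̂ q̂} → ReducedRep d z p q → ReducedRep d (zhat d i z) p̂ q̂ →
                              normω q ≡ normω q̂
  reflection-preserves-norm i {z} {p} {q} {p̂} {q̂} rep rep̂ = begin
    normω q   ≡⟨ norm≡μ q ⟩
    + μ q     ≡⟨ cong +_ (∣-antisym μq∣μq̂ μq̂∣μq) ⟩
    + μ q̂     ≡⟨ norm≡μ q̂ ⟨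
    normω q̂   ∎
    where
    open ≡-Reasoning
    open Σ (reflected-fraction i z p q (proj₂ (proj₂ rep))) renaming (proj₁ to p′; proj₂ to ẑq̄≡p′)
    open Σ (reflected-fraction i (zhat d i z) p̂ q̂ (proj₂ (proj₂ rep̂))) renaming (proj₁ to p̂′; proj₂ to ẑ̂q̂̄≡p̂′)
    μq̂∣μq : μ q̂ ∣ℕ μ q
    μq̂∣μq = subst (μ q̂ ∣ℕ_) (μ-conj q) (μ-∣ {q̂} {conjω q} (reduced-denominator-∣ (zhat d i z) p̂ q̂ p′ (conjω q) rep̂ ẑq̄≡p′))
    μq∣μq̂ : μ q ∣ℕ μ q̂
    μq∣μq̂ = subst (μ q ∣ℕ_) (μ-conj q̂) (μ-∣ {q} {conjω q̂} (reduced-denominator-∣ z p q p̂′ (conjω q̂) rep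
      (subst (λ w → mulQ d w (toQF d (conjω q̂)) ≡ toQF d p̂′) (zhat-involutive d i z) ẑ̂q̂̄≡p̂′)))

  fordRadius-norm : ∀ q → fordRadius d q ≡ qinv ((+ 2) // 1 ℚ.* ℤtoℚ (normω q))
  fordRadius-norm q = cong (λ x → qinv ((+ 2) // 1 ℚ.* x)) (absSq-toQF q)

lemma3 : (d : D) (i : Fin (nEdges d)) (z : QF) →
    Σ QF (λ ẑ → (embed d ẑ ≡ reflect d (edge d i) (embed d z))
      × (∀ p q p̂ q̂ → ReducedRep d z p q → ReducedRep d ẑ p̂ q̂ →
           fordRadius d q ≡ fordRadius d q̂))
lemma3 d i z = zhat d i z , embed-zhat d i z , λ _ q _ q̂ rep rep̂ → begin
  fordRadius d q                          ≡⟨ fordRadius-norm q ⟩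
  qinv ((+ 2) // 1 ℚ.* ℤtoℚ (normω q))    ≡⟨ cong (λ N → qinv ((+ 2) // 1 ℚ.* ℤtoℚ N)) (reflection-preserves-norm i rep rep̂) ⟩
  qinv ((+ 2) // 1 ℚ.* ℤtoℚ (normω q̂))    ≡⟨ fordRadius-norm q̂ ⟨
  fordRadius d q̂                          ∎
  where
  open ≡-Reasoning
  open RingOfIntegers d using (normω; fordRadius-norm; reflection-preserves-norm)
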